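{- Let $G$ be a finite abelian group, let $S\subseteq G\setminus\{0\}$ be a symmetric subset, and let $f=\mathbf{1}_S:G\to\{0,1\}$ be its indicator function. Let $H$ be a connected bipartite graph with $n$ vertices and $k$ edges $\epsilon_1,\dots,\epsilon_k$, and let $L\in\{ -1,0,1\}^{m\times k}$ be a circuit matrix of $H$ (with columns indexed by $\epsilon_1,\dots,\epsilon_k$ in this order). Then \[ t(H,\mathrm{Cay}(G,S)) \;=\; \mathbb{E}_{(x_1,\dots,x_k)\in\ker(L)} f(x_1)\cdots f(x_k), \] where $\ker(L)=\{(x_1,\dots,x_k)\in G^k : \sum_{j=1}^k L_{ij}x_j=0 \text{ for all } i\in[m]\}$ and the expectation is the uniform average over $\ker(L)$.
   Context: For graphs $H$ and $F$, $\hom(H,F)$ is the number of maps $\phi:V(H)\to V(F)$ with $\phi(u)\phi(v)\in E(F)$ whenever $uv\in E(H)$, and $t(H,F)=\hom(H,F)/|V(F)|^{|V(H)|}$. For a finite abelian group $G$ (written additively) and symmetric $S\subseteq G\setminus\{0\}$ (i.e. $S=-S$), $\mathrm{Cay}(G,S)$ is the graph on vertex set $G$ in which $x,y$ are adjacent iff $y-x\in S$. Circuit matrix: let $H$ be a connected bipartite graph with $n$ vertices and edge set $E=\{\epsilon_1,\dots,\epsilon_k\}$; fix a spanning tree $T\subseteq E$, and let $m=k-n+1$. The edges of $E\setminus T$ are ordered as $e_1,\dots,e_m$; for each $i$, $C_{e_i}$ is the unique cycle contained in $T\cup\{e_i\}$ (the fundamental cycle). For each $i\in[m]$ fix a proper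 edge colouring of the (even) cycle $C_{e_i}$ with two colours $+1$ and $-1$ (so consecutive edges of the cycle get different colours). The circuit matrix $L=(L_{ij})\in\{ -1,0,1\}^{m\times k}$ has $L_{ij}=+1$ if $\epsilon_j\in C_{e_i}$ has colour $+1$, $L_{ij}=-1$ if $\epsilon_j\in C_{e_i}$ has colour $-1$, and $L_{ij}=0$ if $\epsilon_j\notin C_{e_i}$. -}

module Defs where

open import Level using (Level; _⊔_; 0ℓ)
open import Algebra.Bundles using (AbelianGroup)
open import Data.Bool using (Bool; true; false; if_then_else_; _∧_)
open import Data.Nat using (ℕ; zero; suc; _+_; _*_; _<_; _≤_; _<?_)
open import Data.Integer using (ℤ; +_; -[1+_]; -_)
open import Data.Rational using (ℚ; 0ℚ) renaming (_/_ to _/ℚ_)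
open import Data.Fin using (Fin; zero; suc; toℕ; fromℕ<; fromℕ; inject₁)
open import Data.Vec.Functional using (_∷_)
open import Data.Product using (Σ; ∃; _×_; _,_; proj₁; proj₂)
open import Data.Sum using (_⊎_)
open import Relation.Nullary using (¬_; Dec; yes; no)
open import Relation.Binary.PropositionalEquality using (_≡_; _≢_)
open import Function.Definitions using (Injective)

sumFin : (N : ℕ) → (Fin N → ℕ) → ℕ
sumFin zero    w = 0
sumFin (suc N) w = w zero + sumFin N (λ i → w (suc i))

prodFin : (N : ℕ) → (Fin N → ℕ) → ℕ
prodFin zero    w = 1
prodFin (suc N) w = w zero * prodFin N (λ i → w (suc i))

allFin : (N : ℕ) → (Fin N → Bool) → Bool
allFin zero    P = true
allFin (suc N) P = P zero ∧ allFin N (λ i → P (suc i))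

-- Sum of a weight over ALL functions Fin k → A, where A is enumerated
-- (bijectively) by  en : Fin N → A.
sumFuns : ∀ {a} {A : Set a} (N : ℕ) → (Fin N → A) → (k : ℕ) → ((Fin k → A) → ℕ) → ℕ
sumFuns N en zero    w = w (λ ())
sumFuns N en (suc k) w = sumFin N (λ i → sumFuns N en k (λ g → w (en i ∷ g)))

-- Rational p / d (d is always positive where used; 0 for d = 0).
ratio : ℕ → ℕ → ℚ
ratio p zero    = 0ℚ
ratio p (suc d) = (+ p) /ℚ (suc d)

record FiniteAbelianGroup (c ℓ : Level) : Set (Level.suc (c ⊔ ℓ)) where
  field
    abGroup : AbelianGroup c ℓ
  open AbelianGroup abGroup public
  field
    _≟_      : (x y : Carrier) → Dec (x ≈ y)
    size     : ℕ
    enum     : Fin size → Carrier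
    enum-inj : ∀ {i j} → enum i ≈ enum j → i ≡ j
    enum-sur : ∀ x → ∃ λ i → enum i ≈ x

  isZero : Carrier → Bool
  isZero x with x ≟ ε
  ... | yes _ = true
  ... | no  _ = false

  natMul : ℕ → Carrier → Carrier
  natMul zero    x = ε
  natMul (suc n) x = x ∙ natMul n x

  intMul : ℤ → Carrier → Carrier
  intMul (+ n)    x = natMul n x
  intMul -[1+ n ] x = natMul (suc n) x ⁻¹

  gsum : (k : ℕ) → (Fin k → Carrier) → Carrier
  gsum zero    x = ε
  gsum (suc k) x = x zero ∙ gsum k (λ j → x (suc j))

record SymSubset {c ℓ} (G : FiniteAbelianGroup c ℓ) : Set (c ⊔ ℓ) where
  open FiniteAbelianGroup G
  field
    mem       : Carrier → Bool
    mem-resp  : ∀ {x y} → x ≈ y → mem x ≡ mem y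
    zero∉     : mem ε ≡ false
    symmetric : ∀ x → mem (x ⁻¹) ≡ mem x

record Graph (n k : ℕ) : Set where
  field
    endpoints : Fin k → Fin n × Fin n

  Joins : Fin k → Fin n → Fin n → Set
  Joins j u v = (proj₁ (endpoints j) ≡ u × proj₂ (endpoints j) ≡ v)
              ⊎ (proj₁ (endpoints j) ≡ v × proj₂ (endpoints j) ≡ u)

open Graph public

Simple : ∀ {n k} → Graph n k → Set
Simple H = (∀ j → proj₁ (endpoints H j) ≢ proj₂ (endpoints H j))
         × (∀ j j' u v → Joins H j u v → Joins H j' u v → j ≡ j')

Bipartite : ∀ {n k} → Graph n k → Set
Bipartite {n} H = Σ (Fin n → Bool) λ col →
  ∀ j → col (proj₁ (endpoints H j)) ≢ col (proj₂ (endpoints H j))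

record Walk {n k} (H : Graph n k) (E' : Fin k → Set) (u v : Fin n) : Set where
  field
    len   : ℕ
    verts : Fin (suc len) → Fin n
    start : verts zero ≡ u
    end   : verts (fromℕ len) ≡ v
    steps : ∀ (t : Fin len) → ∃ λ j → E' j × Joins H j (verts (inject₁ t)) (verts (suc t))

ConnectedVia : ∀ {n k} → Graph n k → (Fin k → Set) → Set
ConnectedVia {n} H E' = ∀ (u v : Fin n) → Walk H E' u v

Connected : ∀ {n k} → Graph n k → Set
Connected H = ConnectedVia H (λ _ → Data.Unit.⊤)
  where import Data.Unit

cyc : ∀ {p} → Fin (suc p) → Fin (suc p)
cyc {p} i with toℕ i <? p
... | yes lt = suc (fromℕ< lt)
... | no  _  = zero

record Cycle {n k} (H : Graph n k) (E' : Fin k → Set) : Set where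
  field
    p       : ℕ
    long    : 2 ≤ p
    verts   : Fin (suc p) → Fin n
    edges   : Fin (suc p) → Fin k
    vinj    : Injective _≡_ _≡_ verts
    einj    : Injective _≡_ _≡_ edges
    inE'    : ∀ t → E' (edges t)
    joins   : ∀ t → Joins H (edges t) (verts t) (verts (cyc t))

SpanningTree : ∀ {n k} → Graph n k → (Fin k → Bool) → Set
SpanningTree H T = ConnectedVia H (λ j → T j ≡ true)
                 × ¬ Cycle H (λ j → T j ≡ true)

NonTreeOrder : ∀ {k} → (Fin k → Bool) → (m : ℕ) → (Fin m → Fin k) → Set
NonTreeOrder {k} T m e = Injective _≡_ _≡_ e
                       × (∀ i → T (e i) ≡ false)
                       × (∀ j → T j ≡ false → ∃ λ i → e i ≡ j)

-- Row i of L is a proper ±1 colouring of a cycle C contained in T ∪ {e_i}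
-- (necessarily the fundamental cycle C_{e_i}), and 0 off C.
IsCircuitMatrix : ∀ {n k} (H : Graph n k) (T : Fin k → Bool) (m : ℕ)
                  (e : Fin m → Fin k) (L : Fin m → Fin k → ℤ) → Set
IsCircuitMatrix {n} {k} H T m e L = ∀ (i : Fin m) →
  Σ (Cycle H (λ j → T j ≡ true ⊎ j ≡ e i)) λ C →
    let open Cycle C in
      (∀ t → L i (edges t) ≡ + 1 ⊎ L i (edges t) ≡ -[1+ 0 ])
    × (∀ t → L i (edges (cyc t)) ≡ - L i (edges t))
    × (∀ j → (∀ t → edges t ≢ j) → L i j ≡ + 0)

module _ {c ℓ} (G : FiniteAbelianGroup c ℓ) (S : SymSubset G) where
  open FiniteAbelianGroup G
  open SymSubset S

  cayAdj : Carrier → Carrier → Bool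
  cayAdj x y = mem (y ∙ x ⁻¹)

  homCount : ∀ {n k} → Graph n k → ℕ
  homCount {n} {k} H = sumFuns size enum n λ φ →
    if allFin k (λ j → cayAdj (φ (proj₁ (endpoints H j))) (φ (proj₂ (endpoints H j))))
    then 1 else 0

  tDensity : ∀ {n k} → Graph n k → ℚ
  tDensity {n} H = ratio (homCount H) (size Data.Nat.^ n)
    where import Data.Nat

  f : Carrier → ℕ
  f x = if mem x then 1 else 0

  inKer : ∀ {m k} → (Fin m → Fin k → ℤ) → (Fin k → Carrier) → Bool
  inKer {m} {k} L x = allFin m λ i → isZero (gsum k (λ j → intMul (L i j) (x j)))

  kerAverage : ∀ {m} (k : ℕ) → (Fin m → Fin k → ℤ) → ℚ
  kerAverage k L =
    ratio (sumFuns size enum k (λ x → if inKer L x then prodFin k (λ j → f (x j)) else 0))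
          (sumFuns size enum k (λ x → if inKer L x then 1 else 0))

module Submission where

-- Orient every edge of H away from its endpoint of colour false and let δ : Gⁿ → Gᵏ be the
-- coboundary, (δ φ)(u → v) = φ v − φ u.  As S = −S, φ is a homomorphism H → Cay(G,S) iff every
-- coordinate of δ φ lies in S, so hom(H, Cay(G,S)) = Σ_φ Π_j f((δ φ)_j).  The image of δ is ker L.
-- A row of L is an alternating ±1 labelling of an even cycle, and bipartiteness makes the
-- orientations alternate as well, so the row applied to δ φ telescopes to 0.  Conversely, for
-- x ∈ ker L integrate x along the spanning tree T; this is well defined because a closed walk in
-- a forest of a simple graph must backtrack somewhere, so its weight cancels away.  The resulting
-- φ has δ φ = x on tree edges, and the row of e_i forces δ φ = x at e_i as well.  Finally all fibres
-- of the homomorphism δ have |ker δ| elements, so hom(H, Cay(G,S)) and |G|ⁿ are |ker δ| times the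
-- corresponding sums over ker L, and |ker δ| cancels in the ratio.

open import Defs
open import Level using (_⊔_)
open import Algebra.Bundles using (CommutativeMonoid; Group; AbelianGroup)
open import Data.Bool using (Bool; true; false; if_then_else_; not; _∧_; _xor_)
open import Data.Bool.Properties using (¬-not; not-involutive)
open import Data.Empty using (⊥-elim)
open import Data.Fin using (Fin; zero; suc; toℕ; fromℕ; inject₁; punchIn)
import Data.Fin.Properties as Fin
open import Data.Integer using (ℤ; +_; -[1+_]; -_)
import Data.Integer as ℤ using (_*_)
import Data.Integer.Properties as ℤ
open import Data.Nat using (ℕ; zero; suc; _+_; _∸_; _*_; _^_; _<_; _≤_; _<?_; z≤n; s≤s; z<s; s≤s⁻¹)
import Data.Nat.Properties as ℕ
open import Data.Product using (Σ; ∃; ∃₂; _×_; _,_; proj₁; proj₂)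
import Data.Rational.Properties as ℚ
open import Data.Rational.Unnormalised using (mkℚᵘ; *≡*)
open import Data.Sum using (_⊎_; inj₁; inj₂)
open import Data.Vec.Functional using (_∷_)
open import Function using (_∘_; id)
open import Relation.Nullary using (¬_; Dec; yes; no; does)
open import Relation.Binary.PropositionalEquality as ≡ using (_≡_; _≢_)
open import Relation.Binary.Definitions using (DecidableEquality)
open import Relation.Binary.Construct.Closure.ReflexiveTransitive
  using (Star; _◅_; _◅◅_; revApp; reverse) renaming (ε to [])

ratio-cross : ∀ {p q d d'} → d ≢ 0 → d' ≢ 0 → p * d' ≡ q * d → ratio p d ≡ ratio q d'
ratio-cross {d = zero}  d≢0 _    _ = ⊥-elim (d≢0 ≡.refl)
ratio-cross {d' = zero} _   d'≢0 _ = ⊥-elim (d'≢0 ≡.refl)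
ratio-cross {p} {q} {suc d} {suc d'} _ _ eq =
  ℚ.fromℚᵘ-cong {mkℚᵘ (+ p) d} {mkℚᵘ (+ q) d'} (*≡* (begin
    + p ℤ.* + suc d'  ≡⟨ ℤ.pos-* p (suc d') ⟨
    + (p * suc d')    ≡⟨ ≡.cong +_ eq ⟩
    + (q * suc d)     ≡⟨ ℤ.pos-* q (suc d) ⟩
    + q ℤ.* + suc d   ∎))
  where open ≡.≡-Reasoning

ratio-*-cancelˡ : ∀ c {p d} → c * d ≢ 0 → ratio (c * p) (c * d) ≡ ratio p d
ratio-*-cancelˡ c {p} {d} cd≢0 = ratio-cross cd≢0 d≢0 (begin
  c * p * d    ≡⟨ ≡.cong (_* d) (ℕ.*-comm c p) ⟩
  p * c * d    ≡⟨ ℕ.*-assoc p c d ⟩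
  p * (c * d)  ∎)
  where
  open ≡.≡-Reasoning
  d≢0 : d ≢ 0
  d≢0 d≡0 = cd≢0 (≡.trans (≡.cong (c *_) d≡0) (ℕ.*-zeroʳ c))

𝟙 : Bool → ℕ
𝟙 b = if b then 1 else 0

if-then-0≡*𝟙 : ∀ b (x : ℕ) → (if b then x else 0) ≡ x * 𝟙 b
if-then-0≡*𝟙 true  x = ≡.sym (ℕ.*-identityʳ x)
if-then-0≡*𝟙 false x = ≡.sym (ℕ.*-zeroʳ x)

bool-ext : ∀ {b b' : Bool} → (b ≡ true → b' ≡ true) → (b' ≡ true → b ≡ true) → b ≡ b'
bool-ext {true}  {true}  _ _ = ≡.refl
bool-ext {true}  {false} ⇒ _ = ≡.sym (⇒ ≡.refl)
bool-ext {false} {true}  _ ⇐ = ⇐ ≡.refl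
bool-ext {false} {false} _ _ = ≡.refl

not-xor-not : ∀ a b → not a xor not b ≡ a xor b
not-xor-not true  b = ≡.refl
not-xor-not false b = not-involutive b

isNeg : ℤ → Bool
isNeg (+ _)    = false
isNeg -[1+ _ ] = true

allFin-intro : ∀ N {P : Fin N → Bool} → (∀ i → P i ≡ true) → allFin N P ≡ true
allFin-intro zero    _ = ≡.refl
allFin-intro (suc N) h rewrite h zero = allFin-intro N (h ∘ suc)

allFin-elim : ∀ N {P : Fin N → Bool} → allFin N P ≡ true → ∀ i → P i ≡ true
allFin-elim (suc N) {P} h i with P zero in P₀
allFin-elim (suc N) h zero    | true = P₀
allFin-elim (suc N) h (suc i) | true = allFin-elim N h i

prodFin-cong : ∀ N {f g : Fin N → ℕ} → (∀ i → f i ≡ g i) → prodFin N f ≡ prodFin N g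
prodFin-cong zero    _ = ≡.refl
prodFin-cong (suc N) h = ≡.cong₂ _*_ (h zero) (prodFin-cong N (h ∘ suc))

𝟙-allFin : ∀ N (P : Fin N → Bool) → 𝟙 (allFin N P) ≡ prodFin N (𝟙 ∘ P)
𝟙-allFin zero    P = ≡.refl
𝟙-allFin (suc N) P with P zero
... | true  = ≡.trans (𝟙-allFin N (P ∘ suc)) (≡.sym (ℕ.+-identityʳ _))
... | false = ≡.refl

Fin-inhabited? : ∀ N → Dec (Fin N)
Fin-inhabited? zero    = no λ ()
Fin-inhabited? (suc N) = yes zero

cyc-inject₁ : ∀ {p} (t : Fin p) → cyc (inject₁ t) ≡ suc t
cyc-inject₁ {p} t with toℕ (inject₁ t) <? p
... | yes lt = ≡.cong suc (Fin.toℕ-injective (≡.trans (Fin.toℕ-fromℕ< lt) (Fin.toℕ-inject₁ t)))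
... | no ≮p  = ⊥-elim (≮p (≡.subst (_< p) (≡.sym (Fin.toℕ-inject₁ t)) (Fin.toℕ<n t)))

cyc-fromℕ : ∀ p → cyc (fromℕ p) ≡ zero
cyc-fromℕ p with toℕ (fromℕ p) <? p
... | yes lt = ⊥-elim (ℕ.<-irrefl (Fin.toℕ-fromℕ p) lt)
... | no _   = ≡.refl

toℕ-cyc : ∀ {p} (t : Fin (suc p)) →
          (toℕ t < p × toℕ (cyc t) ≡ suc (toℕ t)) ⊎ (toℕ t ≡ p × cyc t ≡ zero)
toℕ-cyc {p} t with toℕ t <? p
... | yes lt = inj₁ (lt , ≡.cong suc (Fin.toℕ-fromℕ< lt))
... | no ≮p  = inj₂ (ℕ.≤-antisym (s≤s⁻¹ (Fin.toℕ<n t)) (ℕ.≮⇒≥ ≮p) , ≡.refl)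

cyc-induction : ∀ {p ℓ} (P : Fin (suc p) → Set ℓ) → P zero → (∀ t → P t → P (cyc t)) → ∀ t → P t
cyc-induction {p} P P₀ step t = go (toℕ t) t ≡.refl
  where
  go : ∀ r (t : Fin (suc p)) → toℕ t ≡ r → P t
  go zero    zero    _ = P₀
  go (suc r) (suc t) e = ≡.subst P (cyc-inject₁ t)
    (step (inject₁ t) (go r (inject₁ t) (≡.trans (Fin.toℕ-inject₁ t) (ℕ.suc-injective e))))

-- cyc adds 1 modulo p + 1, and 2 ≢ 0 modulo p + 1 once p ≥ 2.
cyc∘cyc≢id : ∀ {p} → 2 ≤ p → (t : Fin (suc p)) → cyc (cyc t) ≢ t
cyc∘cyc≢id {p} 1<p t cyc²t≡t with toℕ-cyc t | toℕ-cyc (cyc t)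
... | inj₁ (_ , c₁) | inj₁ (_ , c₂) =
  ℕ.m≢1+n+m (toℕ t) {1} (≡.trans (≡.cong toℕ (≡.sym cyc²t≡t)) (≡.trans c₂ (≡.cong suc c₁)))
... | inj₁ (_ , c₁) | inj₂ (c≡p , c₂) =
  ℕ.<⇒≢ 1<p (≡.trans (≡.sym (≡.cong (suc ∘ toℕ) (≡.trans (≡.sym cyc²t≡t) c₂)))
                      (≡.trans (≡.sym c₁) c≡p))
... | inj₂ (t≡p , c₁) | inj₁ (_ , c₂) =
  ℕ.<⇒≢ 1<p (≡.trans (≡.sym (≡.trans c₂ (≡.cong (suc ∘ toℕ) c₁)))
                      (≡.trans (≡.cong toℕ cyc²t≡t) t≡p))
... | inj₂ (_ , c₁) | inj₂ (c≡p , _) =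
  ℕ.<⇒≢ (ℕ.<-trans z<s 1<p) (≡.trans (≡.sym (≡.cong toℕ c₁)) c≡p)

module CommutativeMonoidSums {a ℓ} (M : CommutativeMonoid a ℓ) where
  open CommutativeMonoid M renaming (Carrier to C; ε to 0#)
  open import Algebra.Properties.CommutativeMonoid.Sum M public
  open import Relation.Binary.Reasoning.Setoid setoid

  sum-zero : ∀ {N} {f : Fin N → C} → (∀ i → f i ≈ 0#) → sum f ≈ 0#
  sum-zero {N} f≈0 = trans (sum-cong-≋ f≈0) (sum-replicate-zero N)

  sum-single : ∀ {N} {f : Fin N → C} i → (∀ j → j ≢ i → f j ≈ 0#) → sum f ≈ f i
  sum-single {suc N} {f} i off = begin
    sum f                      ≈⟨ sum-remove f ⟩
    f i ∙ sum (f ∘ punchIn i)  ≈⟨ ∙-congˡ (sum-zero (λ j → off _ (Fin.punchInᵢ≢i i j))) ⟩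
    f i ∙ 0#                   ≈⟨ identityʳ (f i) ⟩
    f i                        ∎

  sum-reindex : ∀ {K A} (e : Fin A → Fin K) → (∀ {s t} → e s ≡ e t → s ≡ t) →
                (f : Fin K → C) → (∀ j → (∀ t → e t ≢ j) → f j ≈ 0#) → sum f ≈ sum (f ∘ e)
  sum-reindex {K} {A} e e-inj f off = begin
    sum f                           ≈⟨ sum-cong-≋ spread ⟩
    ∑[ j < K ] ∑[ t < A ] hit t j   ≈⟨ ∑-comm (λ j t → hit t j) ⟩
    ∑[ t < A ] ∑[ j < K ] hit t j   ≈⟨ sum-cong-≋ collapse ⟩
    sum (f ∘ e)                     ∎
    where
    hit : Fin A → Fin K → C
    hit t j = if does (e t Fin.≟ j) then f j else 0#
    hit-at : ∀ {t j} → e t ≡ j → hit t j ≈ f j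
    hit-at {t} {j} eₜ≡j with e t Fin.≟ j
    ... | yes _   = refl
    ... | no eₜ≢j = ⊥-elim (eₜ≢j eₜ≡j)
    miss : ∀ {t j} → e t ≢ j → hit t j ≈ 0#
    miss {t} {j} eₜ≢j with e t Fin.≟ j
    ... | yes eₜ≡j = ⊥-elim (eₜ≢j eₜ≡j)
    ... | no _     = refl
    collapse : ∀ t → ∑[ j < K ] hit t j ≈ f (e t)
    collapse t = trans (sum-single (e t) (λ j j≢eₜ → miss (j≢eₜ ∘ ≡.sym))) (hit-at ≡.refl)
    spread : ∀ j → f j ≈ ∑[ t < A ] hit t j
    spread j with Fin.any? (λ t → e t Fin.≟ j)
    ... | yes (t , eₜ≡j) = sym (trans (sum-single t others) (hit-at eₜ≡j))
      where
      others : ∀ s → s ≢ t → hit s j ≈ 0#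
      others s s≢t = miss (λ eₛ≡j → s≢t (e-inj (≡.trans eₛ≡j (≡.sym eₜ≡j))))
    ... | no ∄t = trans (off j ∉image) (sym (sum-zero (miss ∘ ∉image)))
      where
      ∉image : ∀ t → e t ≢ j
      ∉image t eₜ≡j = ∄t (t , eₜ≡j)

  sum-rotate : ∀ {p} (f : Fin (suc p) → C) → sum (f ∘ cyc) ≈ sum f
  sum-rotate {p} f = begin
    sum (f ∘ cyc)                                ≈⟨ sum-init-last (f ∘ cyc) ⟩
    sum (f ∘ cyc ∘ inject₁) ∙ f (cyc (fromℕ p))  ≡⟨ ≡.cong₂ _∙_ (sum-cong-≗ (≡.cong f ∘ cyc-inject₁))
                                                                (≡.cong f (cyc-fromℕ p)) ⟩
    sum (f ∘ suc) ∙ f zero                       ≈⟨ comm _ _ ⟩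
    sum f                                        ∎

module AbelianGroupSums {a ℓ} (A : AbelianGroup a ℓ) where
  open AbelianGroup A
  open CommutativeMonoidSums commutativeMonoid public
  open import Algebra.Properties.AbelianGroup A
  open import Relation.Binary.Reasoning.Setoid setoid

  sum-⁻¹ : ∀ {N} (f : Fin N → Carrier) → sum (λ i → f i ⁻¹) ≈ sum f ⁻¹
  sum-⁻¹ {zero}  f = sym ε⁻¹≈ε
  sum-⁻¹ {suc N} f = trans (∙-congˡ (sum-⁻¹ (f ∘ suc))) (⁻¹-∙-comm _ _)

  sum-- : ∀ {N} (f g : Fin N → Carrier) → sum (λ i → f i - g i) ≈ sum f - sum g
  sum-- f g = trans (∑-distrib-+ f (λ i → g i ⁻¹)) (∙-congˡ (sum-⁻¹ g))

  summand-determined : ∀ {N} {f g : Fin N → Carrier} i → (∀ j → j ≢ i → f j ≈ g j) →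
                       sum f ≈ sum g → f i ≈ g i
  summand-determined {f = f} {g} i agree Σf≈Σg = x∙y⁻¹≈ε⇒x≈y _ _ (begin
    f i - g i              ≈⟨ sum-single i (λ j j≢i → x≈y⇒x∙y⁻¹≈ε (agree j j≢i)) ⟨
    sum (λ j → f j - g j)  ≈⟨ sum-- f g ⟩
    sum f - sum g          ≈⟨ x≈y⇒x∙y⁻¹≈ε Σf≈Σg ⟩
    ε                      ∎)

module ℕSums = CommutativeMonoidSums ℕ.+-0-commutativeMonoid

sumFin≡sum : ∀ N (f : Fin N → ℕ) → sumFin N f ≡ ℕSums.sum f
sumFin≡sum zero    f = ≡.refl
sumFin≡sum (suc N) f = ≡.cong₂ _+_ ≡.refl (sumFin≡sum N (f ∘ suc))

sumFin-cong : ∀ N {f g : Fin N → ℕ} → (∀ i → f i ≡ g i) → sumFin N f ≡ sumFin N g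
sumFin-cong zero    _ = ≡.refl
sumFin-cong (suc N) h = ≡.cong₂ _+_ (h zero) (sumFin-cong N (h ∘ suc))

sumFin-const : ∀ N c → sumFin N (λ _ → c) ≡ N * c
sumFin-const zero    c = ≡.refl
sumFin-const (suc N) c = ≡.cong₂ _+_ ≡.refl (sumFin-const N c)

sumFin-*ˡ : ∀ N c (f : Fin N → ℕ) → sumFin N (λ i → c * f i) ≡ c * sumFin N f
sumFin-*ˡ zero    c f = ≡.sym (ℕ.*-zeroʳ c)
sumFin-*ˡ (suc N) c f =
  ≡.trans (≡.cong₂ _+_ ≡.refl (sumFin-*ˡ N c (f ∘ suc))) (≡.sym (ℕ.*-distribˡ-+ c _ _))

sumFin-comm : ∀ A B (f : Fin A → Fin B → ℕ) →
              sumFin A (λ i → sumFin B (f i)) ≡ sumFin B (λ j → sumFin A (λ i → f i j))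
sumFin-comm A B f = begin
  sumFin A (λ i → sumFin B (f i))            ≡⟨ sumFin≡sum A _ ⟩
  ℕSums.sum (λ i → sumFin B (f i))           ≡⟨ ℕSums.sum-cong-≗ (λ i → sumFin≡sum B (f i)) ⟩
  ℕSums.sum (λ i → ℕSums.sum (f i))          ≡⟨ ℕSums.∑-comm f ⟩
  ℕSums.sum (λ j → ℕSums.sum (λ i → f i j))  ≡⟨ ℕSums.sum-cong-≗ (λ j → sumFin≡sum A (λ i → f i j)) ⟨
  ℕSums.sum (λ j → sumFin A (λ i → f i j))   ≡⟨ sumFin≡sum B _ ⟨
  sumFin B (λ j → sumFin A (λ i → f i j))    ∎
  where open ≡.≡-Reasoning

sumFin-single : ∀ N {f : Fin N → ℕ} i → (∀ j → j ≢ i → f j ≡ 0) → sumFin N f ≡ f i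
sumFin-single N {f} i off = ≡.trans (sumFin≡sum N f) (ℕSums.sum-single i off)

module SumFuns {a} {A : Set a} (N : ℕ) (en : Fin N → A) where

  sumFuns-cong : ∀ n {w w' : (Fin n → A) → ℕ} → (∀ φ → w φ ≡ w' φ) →
                 sumFuns N en n w ≡ sumFuns N en n w'
  sumFuns-cong zero    h = h _
  sumFuns-cong (suc n) h = sumFin-cong N (λ i → sumFuns-cong n (h ∘ (en i ∷_)))

  sumFuns-zero : ∀ n {w : (Fin n → A) → ℕ} → (∀ φ → w φ ≡ 0) → sumFuns N en n w ≡ 0
  sumFuns-zero zero    h = h _
  sumFuns-zero (suc n) h = begin
    sumFin N (λ i → sumFuns N en n _)  ≡⟨ sumFin-cong N (λ i → sumFuns-zero n (h ∘ (en i ∷_))) ⟩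
    sumFin N (λ _ → 0)                 ≡⟨ sumFin-const N 0 ⟩
    N * 0                              ≡⟨ ℕ.*-zeroʳ N ⟩
    0                                  ∎
    where open ≡.≡-Reasoning

  sumFuns-*ˡ : ∀ n c (w : (Fin n → A) → ℕ) → sumFuns N en n (λ φ → c * w φ) ≡ c * sumFuns N en n w
  sumFuns-*ˡ zero    c w = ≡.refl
  sumFuns-*ˡ (suc n) c w = ≡.trans (sumFin-cong N (λ i → sumFuns-*ˡ n c _)) (sumFin-*ˡ N c _)

  sumFuns-one : ∀ n → sumFuns N en n (λ _ → 1) ≡ N ^ n
  sumFuns-one zero    = ≡.refl
  sumFuns-one (suc n) = ≡.trans (sumFin-cong N (λ _ → sumFuns-one n)) (sumFin-const N (N ^ n))

  sumFuns-sumFin : ∀ k M (h : Fin M → (Fin k → A) → ℕ) →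
                   sumFuns N en k (λ x → sumFin M (λ i → h i x)) ≡ sumFin M (λ i → sumFuns N en k (h i))
  sumFuns-sumFin zero    M h = ≡.refl
  sumFuns-sumFin (suc k) M h =
    ≡.trans (sumFin-cong N (λ a → sumFuns-sumFin k M (λ i x → h i (en a ∷ x)))) (sumFin-comm N M _)

  sumFuns-comm : ∀ n k (F : (Fin n → A) → (Fin k → A) → ℕ) →
                 sumFuns N en n (λ φ → sumFuns N en k (F φ)) ≡
                 sumFuns N en k (λ x → sumFuns N en n (λ φ → F φ x))
  sumFuns-comm zero    k F = ≡.refl
  sumFuns-comm (suc n) k F =
    ≡.trans (sumFin-cong N (λ i → sumFuns-comm n k (F ∘ (en i ∷_)))) (≡.sym (sumFuns-sumFin k N _))

-- Sums over Gⁿ and the fibres of a homomorphism Gⁿ → Gᵏ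

module GroupFunctionSums {c ℓ} (G : FiniteAbelianGroup c ℓ) where
  open FiniteAbelianGroup G
  open import Algebra.Properties.AbelianGroup abGroup
    using (//-rightDividesˡ; //-rightDividesʳ; identityˡ-unique)
  open SumFuns size enum public

  ∑ᴳ : (n : ℕ) → ((Fin n → Carrier) → ℕ) → ℕ
  ∑ᴳ = sumFuns size enum

  size≢0 : size ≢ 0
  size≢0 size≡0 = Fin.¬Fin0 (≡.subst Fin size≡0 (proj₁ (enum-sur ε)))

  infix 4 _≋_
  infix 5 _≋ᵇ_
  infixl 6 _⊕_

  _≋_ : ∀ {n} → (Fin n → Carrier) → (Fin n → Carrier) → Set ℓ
  φ ≋ ψ = ∀ j → φ j ≈ ψ j

  _≋ᵇ_ : ∀ {n} → (Fin n → Carrier) → (Fin n → Carrier) → Bool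
  _≋ᵇ_ {n} φ ψ = allFin n (λ j → does (φ j ≟ ψ j))

  _⊕_ : ∀ {n} → (Fin n → Carrier) → (Fin n → Carrier) → (Fin n → Carrier)
  (φ ⊕ ψ) j = φ j ∙ ψ j

  Respects≋ : ∀ {n} → ((Fin n → Carrier) → ℕ) → Set (c ⊔ ℓ)
  Respects≋ w = ∀ {φ ψ} → φ ≋ ψ → w φ ≡ w ψ

  ≋ᵇ-sound : ∀ {n} {φ ψ : Fin n → Carrier} → φ ≋ᵇ ψ ≡ true → φ ≋ ψ
  ≋ᵇ-sound {n} {φ} {ψ} h j with φ j ≟ ψ j | allFin-elim n h j
  ... | yes φⱼ≈ψⱼ | _ = φⱼ≈ψⱼ

  ≋ᵇ-complete : ∀ {n} {φ ψ : Fin n → Carrier} → φ ≋ ψ → φ ≋ᵇ ψ ≡ true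
  ≋ᵇ-complete {n} {φ} {ψ} φ≋ψ = allFin-intro n decided
    where
    decided : ∀ j → does (φ j ≟ ψ j) ≡ true
    decided j with φ j ≟ ψ j
    ... | yes _    = ≡.refl
    ... | no φⱼ≉ψⱼ = ⊥-elim (φⱼ≉ψⱼ (φ≋ψ j))

  ≋ᵇ-cong : ∀ {n} {φ ψ φ' ψ' : Fin n → Carrier} → (φ ≋ ψ → φ' ≋ ψ') → (φ' ≋ ψ' → φ ≋ ψ) →
            φ ≋ᵇ ψ ≡ φ' ≋ᵇ ψ'
  ≋ᵇ-cong ⇒ ⇐ = bool-ext (≋ᵇ-complete ∘ ⇒ ∘ ≋ᵇ-sound) (≋ᵇ-complete ∘ ⇐ ∘ ≋ᵇ-sound)

  sumFin-delta : ∀ y (h : Carrier → ℕ) → (∀ {a b} → a ≈ b → h a ≡ h b) →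
                 sumFin size (λ i → if does (enum i ≟ y) then h (enum i) else 0) ≡ h y
  sumFin-delta y h h-resp with enum-sur y
  ... | i₀ , eᵢ₀≈y = ≡.trans (sumFin-single size i₀ off) at-i₀
    where
    off : ∀ i → i ≢ i₀ → (if does (enum i ≟ y) then h (enum i) else 0) ≡ 0
    off i i≢i₀ with enum i ≟ y
    ... | yes eᵢ≈y = ⊥-elim (i≢i₀ (enum-inj (trans eᵢ≈y (sym eᵢ₀≈y))))
    ... | no _     = ≡.refl
    at-i₀ : (if does (enum i₀ ≟ y) then h (enum i₀) else 0) ≡ h y
    at-i₀ with enum i₀ ≟ y
    ... | yes _    = h-resp eᵢ₀≈y
    ... | no eᵢ₀≉y = ⊥-elim (eᵢ₀≉y eᵢ₀≈y)

  ∑ᴳ-delta : ∀ n (y : Fin n → Carrier) (w : (Fin n → Carrier) → ℕ) → Respects≋ w →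
             ∑ᴳ n (λ φ → if φ ≋ᵇ y then w φ else 0) ≡ w y
  ∑ᴳ-delta zero    y w w-resp = w-resp (λ ())
  ∑ᴳ-delta (suc n) y w w-resp = begin
    sumFin size (λ i → ∑ᴳ n (λ φ → if does (enum i ≟ y zero) ∧ (φ ≋ᵇ y ∘ suc) then w (enum i ∷ φ) else 0))
      ≡⟨ sumFin-cong size inner ⟩
    sumFin size (λ i → if does (enum i ≟ y zero) then w (enum i ∷ y ∘ suc) else 0)
      ≡⟨ sumFin-delta (y zero) (λ a → w (a ∷ y ∘ suc)) (λ a≈b → w-resp λ { zero → a≈b ; (suc j) → refl }) ⟩
    w (y zero ∷ y ∘ suc)
      ≡⟨ w-resp (λ { zero → refl ; (suc j) → refl }) ⟩
    w y ∎
    where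
    open ≡.≡-Reasoning
    inner : ∀ i → ∑ᴳ n (λ φ → if does (enum i ≟ y zero) ∧ (φ ≋ᵇ y ∘ suc) then w (enum i ∷ φ) else 0)
                ≡ (if does (enum i ≟ y zero) then w (enum i ∷ y ∘ suc) else 0)
    inner i with does (enum i ≟ y zero)
    ... | true  = ∑ᴳ-delta n (y ∘ suc) (w ∘ (enum i ∷_)) (λ φ≋ψ → w-resp λ { zero → refl ; (suc j) → φ≋ψ j })
    ... | false = sumFuns-zero n (λ _ → ≡.refl)

  ∑ᴳ-translate : ∀ n (h : (Fin n → Carrier) → ℕ) → Respects≋ h → (ψ : Fin n → Carrier) →
                 ∑ᴳ n (λ φ → h (φ ⊕ ψ)) ≡ ∑ᴳ n h
  ∑ᴳ-translate n h h-resp ψ = begin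
    ∑ᴳ n (λ φ → h (φ ⊕ ψ))
      ≡⟨ sumFuns-cong n (λ φ → ∑ᴳ-delta n (φ ⊕ ψ) h h-resp) ⟨
    ∑ᴳ n (λ φ → ∑ᴳ n (λ χ → if χ ≋ᵇ φ ⊕ ψ then h χ else 0))
      ≡⟨ sumFuns-comm n n _ ⟩
    ∑ᴳ n (λ χ → ∑ᴳ n (λ φ → if χ ≋ᵇ φ ⊕ ψ then h χ else 0))
      ≡⟨ sumFuns-cong n (λ χ → sumFuns-cong n (λ φ → ≡.cong (λ b → if b then h χ else 0) (shift χ φ))) ⟩
    ∑ᴳ n (λ χ → ∑ᴳ n (λ φ → if φ ≋ᵇ (λ j → χ j - ψ j) then h χ else 0))
      ≡⟨ sumFuns-cong n (λ χ → ∑ᴳ-delta n _ (λ _ → h χ) (λ _ → ≡.refl)) ⟩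
    ∑ᴳ n h ∎
    where
    open ≡.≡-Reasoning
    shift : ∀ χ φ → (χ ≋ᵇ φ ⊕ ψ) ≡ (φ ≋ᵇ λ j → χ j - ψ j)
    shift χ φ = ≋ᵇ-cong
      (λ χ≋φ⊕ψ j → sym (trans (∙-congʳ (χ≋φ⊕ψ j)) (//-rightDividesʳ (ψ j) (φ j))))
      (λ φ≋χ-ψ j → sym (trans (∙-congʳ (φ≋χ-ψ j)) (//-rightDividesˡ (ψ j) (χ j))))

  module Fibres {n k} (D : (Fin n → Carrier) → (Fin k → Carrier))
      (D-cong : ∀ {φ ψ} → φ ≋ ψ → D φ ≋ D ψ)
      (D-homo : ∀ φ ψ → D (φ ⊕ ψ) ≋ D φ ⊕ D ψ)
      (K : (Fin k → Carrier) → Bool) (K-resp : ∀ {x y} → x ≋ y → K x ≡ K y)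
      (image⊆K : ∀ φ → K (D φ) ≡ true)
      (K⊆image : ∀ x → K x ≡ true → ∃ λ ψ → x ≋ D ψ) where

    fibre : (Fin k → Carrier) → ℕ
    fibre x = ∑ᴳ n (λ φ → 𝟙 (x ≋ᵇ D φ))

    kernelSize : ℕ
    kernelSize = fibre (λ _ → ε)

    fibre-resp : Respects≋ fibre
    fibre-resp x≋y = sumFuns-cong n (λ φ → ≡.cong 𝟙 (≋ᵇ-cong
      (λ x≋Dφ j → trans (sym (x≋y j)) (x≋Dφ j)) (λ y≋Dφ j → trans (x≋y j) (y≋Dφ j))))

    fibre-image : ∀ x → fibre x ≡ (if K x then kernelSize else 0)
    fibre-image x with K x in Kx
    ... | true with K⊆image x Kx
    ...   | ψ , x≋Dψ = begin
      fibre x                            ≡⟨ fibre-resp x≋Dψ ⟩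
      fibre (D ψ)                        ≡⟨ ∑ᴳ-translate n (λ φ → 𝟙 (D ψ ≋ᵇ D φ)) same-image ψ ⟨
      ∑ᴳ n (λ φ → 𝟙 (D ψ ≋ᵇ D (φ ⊕ ψ)))  ≡⟨ sumFuns-cong n (λ φ → ≡.cong 𝟙 (untranslate φ)) ⟩
      kernelSize                         ∎
      where
      open ≡.≡-Reasoning
      same-image : Respects≋ (λ φ → 𝟙 (D ψ ≋ᵇ D φ))
      same-image φ≋φ' = ≡.cong 𝟙 (≋ᵇ-cong (λ e j → trans (e j) (D-cong φ≋φ' j))
                                          (λ e j → trans (e j) (sym (D-cong φ≋φ' j))))
      untranslate : ∀ φ → (D ψ ≋ᵇ D (φ ⊕ ψ)) ≡ ((λ _ → ε) ≋ᵇ D φ)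
      untranslate φ = ≋ᵇ-cong
        (λ e j → sym (identityˡ-unique _ _ (sym (trans (e j) (D-homo φ ψ j)))))
        (λ e j → trans (sym (identityˡ _)) (trans (∙-congʳ (e j)) (sym (D-homo φ ψ j))))
    fibre-image x | false = sumFuns-zero n outside
      where
      outside : ∀ φ → 𝟙 (x ≋ᵇ D φ) ≡ 0
      outside φ with x ≋ᵇ D φ in x≋Dφ
      ... | false = ≡.refl
      ... | true with ≡.trans (≡.sym Kx) (≡.trans (K-resp (≋ᵇ-sound x≋Dφ)) (image⊆K φ))
      ...   | ()

    ∑ᴳ-∘D : ∀ g → Respects≋ g → ∑ᴳ n (g ∘ D) ≡ kernelSize * ∑ᴳ k (λ x → if K x then g x else 0)
    ∑ᴳ-∘D g g-resp = begin
      ∑ᴳ n (g ∘ D)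
        ≡⟨ sumFuns-cong n (λ φ → ∑ᴳ-delta k (D φ) g g-resp) ⟨
      ∑ᴳ n (λ φ → ∑ᴳ k (λ x → if x ≋ᵇ D φ then g x else 0))
        ≡⟨ sumFuns-comm n k _ ⟩
      ∑ᴳ k (λ x → ∑ᴳ n (λ φ → if x ≋ᵇ D φ then g x else 0))
        ≡⟨ sumFuns-cong k (λ x → sumFuns-cong n (λ φ → if-then-0≡*𝟙 (x ≋ᵇ D φ) (g x))) ⟩
      ∑ᴳ k (λ x → ∑ᴳ n (λ φ → g x * 𝟙 (x ≋ᵇ D φ)))
        ≡⟨ sumFuns-cong k (λ x → sumFuns-*ˡ n (g x) _) ⟩
      ∑ᴳ k (λ x → g x * fibre x)
        ≡⟨ sumFuns-cong k per-x ⟩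
      ∑ᴳ k (λ x → kernelSize * (if K x then g x else 0))
        ≡⟨ sumFuns-*ˡ k kernelSize _ ⟩
      kernelSize * ∑ᴳ k (λ x → if K x then g x else 0) ∎
      where
      open ≡.≡-Reasoning
      per-x : ∀ x → g x * fibre x ≡ kernelSize * (if K x then g x else 0)
      per-x x rewrite fibre-image x with K x
      ... | true  = ℕ.*-comm (g x) kernelSize
      ... | false = ≡.trans (ℕ.*-zeroʳ (g x)) (≡.sym (ℕ.*-zeroʳ kernelSize))

-- Closed walks in a forest

InjectiveBelow : ∀ {a} {A : Set a} → (ℕ → A) → ℕ → Set a
InjectiveBelow V b = ∀ {s t} → s < b → t < b → V s ≡ V t → s ≡ t

FirstRepeatWithin : ∀ {a} {A : Set a} → (ℕ → A) → ℕ → Set a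
FirstRepeatWithin V L =
  ∃₂ λ s g → suc (g + s) ≤ L × V s ≡ V (suc (g + s)) × InjectiveBelow V (suc (g + s))

module _ {a} {A : Set a} (_≟ᴬ_ : DecidableEquality A) (V : ℕ → A) where

  injectiveBelow-or-repeat : ∀ b → InjectiveBelow V (suc b) ⊎ FirstRepeatWithin V b
  injectiveBelow-or-repeat zero = inj₁ λ { (s≤s z≤n) (s≤s z≤n) _ → ≡.refl }
  injectiveBelow-or-repeat (suc b) with injectiveBelow-or-repeat b
  ... | inj₂ (s , g , ≤b , rep , inj) = inj₂ (s , g , ℕ.m≤n⇒m≤1+n ≤b , rep , inj)
  ... | inj₁ inj with ℕ.anyUpTo? (λ s → V s ≟ᴬ V (suc b)) (suc b)
  ...   | yes (s , s≤b , rep) =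
    inj₂ (s , b ∸ s , ℕ.≤-reflexive gap , ≡.subst (λ c → V s ≡ V c) (≡.sym gap) rep ,
          ≡.subst (InjectiveBelow V) (≡.sym gap) inj)
    where
    gap : suc (b ∸ s + s) ≡ suc b
    gap = ≡.cong suc (ℕ.m∸n+n≡m (s≤s⁻¹ s≤b))
  ...   | no no-repeat = inj₁ extended
    where
    extended : InjectiveBelow V (suc (suc b))
    extended s< t< Vₛ≡Vₜ with ℕ.m<1+n⇒m<n∨m≡n s< | ℕ.m<1+n⇒m<n∨m≡n t<
    ... | inj₁ s<′    | inj₁ t<′    = inj s<′ t<′ Vₛ≡Vₜ
    ... | inj₁ s<′    | inj₂ ≡.refl = ⊥-elim (no-repeat (_ , s<′ , Vₛ≡Vₜ))
    ... | inj₂ ≡.refl | inj₁ t<′    = ⊥-elim (no-repeat (_ , t<′ , ≡.sym Vₛ≡Vₜ))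
    ... | inj₂ ≡.refl | inj₂ ≡.refl = ≡.refl

  firstRepeat : ∀ {L} → 0 < L → V 0 ≡ V L → FirstRepeatWithin V L
  firstRepeat {L} 0<L V₀≡V_L with injectiveBelow-or-repeat L
  ... | inj₁ inj = ⊥-elim (ℕ.<⇒≢ 0<L (inj z<s (ℕ.n<1+n L) V₀≡V_L))
  ... | inj₂ rep = rep

Cycle-mono : ∀ {n k} {H : Graph n k} {E₁ E₂ : Fin k → Set} (C : Cycle H E₁) →
             (∀ t → E₁ (Cycle.edges C t) → E₂ (Cycle.edges C t)) → Cycle H E₂
Cycle-mono C inc = record
  { p = p ; long = long ; verts = verts ; edges = edges ; vinj = vinj ; einj = einj
  ; inE' = λ t → inc t (inE' t) ; joins = joins }
  where open Cycle C

module Walks {n k} (H : Graph n k) (E' : Fin k → Set) where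

  Joins-sym : ∀ j {u v} → Joins H j u v → Joins H j v u
  Joins-sym _ (inj₁ p) = inj₂ p
  Joins-sym _ (inj₂ p) = inj₁ p

  Joins-endpoints : ∀ j {a b c d} → Joins H j a b → Joins H j c d →
                    (a ≡ c × b ≡ d) ⊎ (a ≡ d × b ≡ c)
  Joins-endpoints _ (inj₁ (≡.refl , ≡.refl)) (inj₁ (≡.refl , ≡.refl)) = inj₁ (≡.refl , ≡.refl)
  Joins-endpoints _ (inj₁ (≡.refl , ≡.refl)) (inj₂ (≡.refl , ≡.refl)) = inj₂ (≡.refl , ≡.refl)
  Joins-endpoints _ (inj₂ (≡.refl , ≡.refl)) (inj₁ (≡.refl , ≡.refl)) = inj₂ (≡.refl , ≡.refl)
  Joins-endpoints _ (inj₂ (≡.refl , ≡.refl)) (inj₂ (≡.refl , ≡.refl)) = inj₁ (≡.refl , ≡.refl)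

  Step : Fin n → Fin n → Set
  Step u v = ∃ λ j → E' j × Joins H j u v

  flipStep : ∀ {u v} → Step u v → Step v u
  flipStep (j , j∈E' , J) = j , j∈E' , Joins-sym j J

  Steps : Fin n → Fin n → Set
  Steps = Star Step

  length : ∀ {u v} → Steps u v → ℕ
  length []      = 0
  length (_ ◅ p) = suc (length p)

  vertexAt : ∀ {u v} → Steps u v → ℕ → Fin n
  vertexAt {u} []      _       = u
  vertexAt {u} (_ ◅ _) zero    = u
  vertexAt     (_ ◅ p) (suc t) = vertexAt p t

  vertexAt-start : ∀ {u v} (p : Steps u v) → vertexAt p 0 ≡ u
  vertexAt-start []      = ≡.refl
  vertexAt-start (_ ◅ _) = ≡.refl

  vertexAt-end : ∀ {u v} (p : Steps u v) → vertexAt p (length p) ≡ v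
  vertexAt-end []      = ≡.refl
  vertexAt-end (_ ◅ p) = vertexAt-end p

  stepAt : ∀ {u v} (p : Steps u v) {t} → t < length p → Step (vertexAt p t) (vertexAt p (suc t))
  stepAt (x ◅ p) {zero}  _         = ≡.subst (Step _) (≡.sym (vertexAt-start p)) x
  stepAt (x ◅ p) {suc t} (s≤s t<ℓ) = stepAt p t<ℓ

  fromWalk : ∀ {u v} → Walk H E' u v → Steps u v
  fromWalk w = ≡.subst₂ Steps (Walk.start w) (Walk.end w) (go (Walk.len w) (Walk.verts w) (Walk.steps w))
    where
    go : ∀ l (vs : Fin (suc l) → Fin n) → (∀ t → Step (vs (inject₁ t)) (vs (suc t))) →
         Steps (vs zero) (vs (fromℕ l))
    go zero    vs s = []
    go (suc l) vs s = s zero ◅ go l (vs ∘ suc) (s ∘ suc)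

  Step-irreflexive : Simple H → ∀ {u v} → Step u v → u ≢ v
  Step-irreflexive simple (j , _ , inj₁ (e₁ , e₂)) ≡.refl = proj₁ simple j (≡.trans e₁ (≡.sym e₂))
  Step-irreflexive simple (j , _ , inj₂ (e₁ , e₂)) ≡.refl = proj₁ simple j (≡.trans e₁ (≡.sym e₂))

  closedSegment⇒Cycle : (V : ℕ → Fin n) (p : ℕ) → 2 ≤ p → InjectiveBelow V (suc p) → V 0 ≡ V (suc p) →
                        (∀ {t} → t < suc p → Step (V t) (V (suc t))) → Cycle H E'
  closedSegment⇒Cycle V p 2≤p V-inj closed step = record
    { p = p ; long = 2≤p ; verts = verts ; edges = edges ; vinj = vinj ; einj = einj
    ; inE' = λ t → proj₁ (proj₂ (step (Fin.toℕ<n t))) ; joins = joins }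
    where
    verts : Fin (suc p) → Fin n
    verts t = V (toℕ t)
    edges : Fin (suc p) → Fin k
    edges t = proj₁ (step (Fin.toℕ<n t))
    vinj : ∀ {t t'} → verts t ≡ verts t' → t ≡ t'
    vinj {t} {t'} e = Fin.toℕ-injective (V-inj (Fin.toℕ<n t) (Fin.toℕ<n t') e)
    next : ∀ t → V (suc (toℕ t)) ≡ verts (cyc t)
    next t with toℕ-cyc t
    ... | inj₁ (_ , c)   = ≡.cong V (≡.sym c)
    ... | inj₂ (t≡p , c) =
      ≡.trans (≡.cong (V ∘ suc) t≡p) (≡.trans (≡.sym closed) (≡.cong (V ∘ toℕ) (≡.sym c)))
    joins : ∀ t → Joins H (edges t) (verts t) (verts (cyc t))
    joins t = ≡.subst (Joins H (edges t) (verts t)) (next t) (proj₂ (proj₂ (step (Fin.toℕ<n t))))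
    einj : ∀ {t t'} → edges t ≡ edges t' → t ≡ t'
    einj {t} {t'} e with Joins-endpoints (edges t) (joins t) (≡.subst (λ j → Joins H j _ _) (≡.sym e) (joins t'))
    ... | inj₁ (same , _)      = vinj same
    ... | inj₂ (t~ct' , ct~t') =
      ⊥-elim (cyc∘cyc≢id 2≤p t' (≡.trans (≡.cong cyc (≡.sym (vinj t~ct'))) (vinj ct~t')))

  closedWalk-backtrack : Simple H → ¬ Cycle H E' → ∀ {u} (p : Steps u u) → 0 < length p →
                         ∃ λ s → 2 + s ≤ length p × vertexAt p s ≡ vertexAt p (2 + s)
  closedWalk-backtrack simple forest p 0<ℓ
    with firstRepeat Fin._≟_ (vertexAt p) 0<ℓ (≡.trans (vertexAt-start p) (≡.sym (vertexAt-end p)))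
  ... | s , zero       , s<ℓ   , rep , _ = ⊥-elim (Step-irreflexive simple (stepAt p s<ℓ) rep)
  ... | s , suc zero   , bound , rep , _ = s , bound , rep
  ... | s , suc (suc g) , bound , rep , inj =
    ⊥-elim (forest (closedSegment⇒Cycle (λ t → vertexAt p (t + s)) (suc (suc g)) (s≤s (s≤s z≤n))
                                        shifted-inj rep shifted-step))
    where
    shift< : ∀ {t} → t < suc (suc (suc g)) → t + s < suc (suc (suc g) + s)
    shift< = ℕ.+-monoˡ-< s
    shifted-inj : InjectiveBelow (λ t → vertexAt p (t + s)) (suc (suc (suc g)))
    shifted-inj t< t'< e = ℕ.+-cancelʳ-≡ s _ _ (inj (shift< t<) (shift< t'<) e)
    shifted-step : ∀ {t} → t < suc (suc (suc g)) → Step (vertexAt p (t + s)) (vertexAt p (suc t + s))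
    shifted-step t< = stepAt p (ℕ.<-≤-trans (shift< t<) bound)

  module Weights {a ℓ} (𝔾 : Group a ℓ) (w : Fin k → Fin n → Group.Carrier 𝔾)
                 (w-flip : ∀ {j u v} → Joins H j u v → Group._≈_ 𝔾 (w j v) (Group._⁻¹ 𝔾 (w j u))) where
    open Group 𝔾
    open import Algebra.Properties.Group 𝔾
    open import Relation.Binary.Reasoning.Setoid setoid

    stepWeight : ∀ {u v} → Step u v → Carrier
    stepWeight {u} (j , _ , _) = w j u

    weight : ∀ {u v} → Steps u v → Carrier
    weight []      = ε
    weight (x ◅ p) = stepWeight x ∙ weight p

    weight-◅◅ : ∀ {u v w} (p : Steps u v) (q : Steps v w) → weight (p ◅◅ q) ≈ weight p ∙ weight q
    weight-◅◅ []      q = sym (identityˡ _)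
    weight-◅◅ (x ◅ p) q = trans (∙-congˡ (weight-◅◅ p q)) (sym (assoc _ _ _))

    weight-revApp : ∀ {u v w} (p : Steps v u) (q : Steps v w) →
                    weight (revApp flipStep p q) ≈ weight p ⁻¹ ∙ weight q
    weight-revApp []                  q = sym (trans (∙-congʳ ε⁻¹≈ε) (identityˡ _))
    weight-revApp (x@(_ , _ , J) ◅ p) q = begin
      weight (revApp flipStep p (flipStep x ◅ q))         ≈⟨ weight-revApp p (flipStep x ◅ q) ⟩
      weight p ⁻¹ ∙ (stepWeight (flipStep x) ∙ weight q)  ≈⟨ ∙-congˡ (∙-congʳ (w-flip J)) ⟩
      weight p ⁻¹ ∙ (stepWeight x ⁻¹ ∙ weight q)          ≈⟨ assoc _ _ _ ⟨
      weight p ⁻¹ ∙ stepWeight x ⁻¹ ∙ weight q            ≈⟨ ∙-congʳ (⁻¹-anti-homo-∙ _ _) ⟨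
      (stepWeight x ∙ weight p) ⁻¹ ∙ weight q             ∎

    weight-reverse : ∀ {u v} (p : Steps u v) → weight (reverse flipStep p) ≈ weight p ⁻¹
    weight-reverse p = trans (weight-revApp p []) (identityʳ _)

    backtrack-cancels : Simple H → ∀ {u m v} (x : Step u m) (y : Step m u) (r : Steps u v) →
                        weight (x ◅ y ◅ r) ≈ weight r
    backtrack-cancels simple (j , _ , J) (j' , _ , J') r = begin
      w j _ ∙ (w j' _ ∙ weight r)    ≡⟨ ≡.cong (λ i → w j _ ∙ (w i _ ∙ weight r)) same-edge ⟩
      w j _ ∙ (w j _ ∙ weight r)     ≈⟨ ∙-congˡ (∙-congʳ (w-flip J)) ⟩
      w j _ ∙ (w j _ ⁻¹ ∙ weight r)  ≈⟨ \\-leftDividesˡ _ _ ⟩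
      weight r                       ∎
      where
      same-edge : j' ≡ j
      same-edge = proj₂ simple j' j _ _ J' (Joins-sym j J)

    removeBacktrack : Simple H → ∀ {u v} (p : Steps u v) s → 2 + s ≤ length p →
                      vertexAt p s ≡ vertexAt p (2 + s) →
                      Σ (Steps u v) λ q → 2 + length q ≡ length p × weight q ≈ weight p
    removeBacktrack simple (x ◅ y ◅ r) zero _ returns with ≡.trans returns (vertexAt-start r)
    ... | ≡.refl = r , ≡.refl , sym (backtrack-cancels simple x y r)
    removeBacktrack simple (x ◅ p) (suc s) (s≤s bound) returns with removeBacktrack simple p s bound returns
    ... | q , shorter , same = x ◅ q , ≡.cong suc shorter , ∙-congˡ same

    closedWalk-weight : Simple H → ¬ Cycle H E' → ∀ {u} (p : Steps u u) → weight p ≈ ε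
    closedWalk-weight simple forest p = go (length p) p ℕ.≤-refl
      where
      go : ∀ F {u} (p : Steps u u) → length p ≤ F → weight p ≈ ε
      go _       []          _   = refl
      go (suc F) p@(_ ◅ _) ℓ≤F with closedWalk-backtrack simple forest p z<s
      ... | s , bound , returns with removeBacktrack simple p s bound returns
      ...   | q , shorter , same =
        trans (sym same) (go F q (ℕ.≤-trans (ℕ.n≤1+n _) (s≤s⁻¹ (≡.subst (_≤ suc F) (≡.sym shorter) ℓ≤F))))

    weight-pathIndependent : Simple H → ¬ Cycle H E' → ∀ {u v} (p q : Steps u v) → weight p ≈ weight q
    weight-pathIndependent simple forest p q = x∙y⁻¹≈ε⇒x≈y _ _ (begin
      weight p ∙ weight q ⁻¹                  ≈⟨ ∙-congˡ (weight-reverse q) ⟨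
      weight p ∙ weight (reverse flipStep q)  ≈⟨ weight-◅◅ p _ ⟨
      weight (p ◅◅ reverse flipStep q)        ≈⟨ closedWalk-weight simple forest (p ◅◅ reverse flipStep q) ⟩
      ε                                       ∎)

-- The coboundary of a bipartite graph and the kernel of its circuit matrix

module Coboundary {c ℓ} (G : FiniteAbelianGroup c ℓ) {n k} (H : Graph n k) (col : Fin n → Bool)
                  (proper : ∀ j → col (proj₁ (endpoints H j)) ≢ col (proj₂ (endpoints H j))) where
  open FiniteAbelianGroup G
  open import Algebra.Properties.AbelianGroup abGroup
  open import Algebra.Properties.CommutativeSemigroup commutativeSemigroup using (interchange)
  open import Relation.Binary.Reasoning.Setoid setoid
  open GroupFunctionSums G
  open AbelianGroupSums abGroup

  src tgt : Fin k → Fin n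
  src j = proj₁ (endpoints H j)
  tgt j = proj₂ (endpoints H j)

  col-flips : ∀ {j u v} → Joins H j u v → col v ≡ not (col u)
  col-flips {j} (inj₁ (≡.refl , ≡.refl)) = ¬-not (proper j ∘ ≡.sym)
  col-flips {j} (inj₂ (≡.refl , ≡.refl)) = ¬-not (proper j)

  flipIf : Bool → Carrier → Carrier
  flipIf b x = if b then x ⁻¹ else x

  flipIf-cong : ∀ b {x y} → x ≈ y → flipIf b x ≈ flipIf b y
  flipIf-cong true  = ⁻¹-cong
  flipIf-cong false = id

  flipIf-involutive : ∀ b x → flipIf b (flipIf b x) ≈ x
  flipIf-involutive true  = ⁻¹-involutive
  flipIf-involutive false _ = refl

  flipIf-injective : ∀ b {x y} → flipIf b x ≈ flipIf b y → x ≈ y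
  flipIf-injective b {x} {y} e =
    trans (sym (flipIf-involutive b x)) (trans (flipIf-cong b e) (flipIf-involutive b y))

  flipIf-not : ∀ b x → flipIf (not b) x ≈ flipIf b x ⁻¹
  flipIf-not true  x = sym (⁻¹-involutive x)
  flipIf-not false x = refl

  flipIf-xor : ∀ b b' x → flipIf b (flipIf b' x) ≈ flipIf (b xor b') x
  flipIf-xor true  b' x = sym (flipIf-not b' x)
  flipIf-xor false b' x = refl

  flipIf-ε : ∀ b → flipIf b ε ≈ ε
  flipIf-ε true  = ε⁻¹≈ε
  flipIf-ε false = refl

  flipIf-∙ : ∀ b x y → flipIf b (x ∙ y) ≈ flipIf b x ∙ flipIf b y
  flipIf-∙ true  x y = sym (⁻¹-∙-comm x y)
  flipIf-∙ false x y = refl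

  flipIf-sum : ∀ b {N} (f : Fin N → Carrier) → sum (flipIf b ∘ f) ≈ flipIf b (sum f)
  flipIf-sum true  f = sum-⁻¹ f
  flipIf-sum false f = refl

  -- Edge j is oriented away from its endpoint of colour false.
  δ : (Fin n → Carrier) → (Fin k → Carrier)
  δ φ j = flipIf (col (src j)) (φ (tgt j) - φ (src j))

  δ-cong : ∀ {φ ψ} → φ ≋ ψ → δ φ ≋ δ ψ
  δ-cong φ≋ψ j = flipIf-cong (col (src j)) (//-cong₂ (φ≋ψ (tgt j)) (φ≋ψ (src j)))

  δ-homo : ∀ φ ψ → δ (φ ⊕ ψ) ≋ δ φ ⊕ δ ψ
  δ-homo φ ψ j = begin
    flipIf b ((φ (tgt j) ∙ ψ (tgt j)) ∙ (φ (src j) ∙ ψ (src j)) ⁻¹)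
      ≈⟨ flipIf-cong b (∙-congˡ (⁻¹-∙-comm _ _)) ⟨
    flipIf b ((φ (tgt j) ∙ ψ (tgt j)) ∙ (φ (src j) ⁻¹ ∙ ψ (src j) ⁻¹))
      ≈⟨ flipIf-cong b (interchange _ _ _ _) ⟩
    flipIf b ((φ (tgt j) - φ (src j)) ∙ (ψ (tgt j) - ψ (src j)))
      ≈⟨ flipIf-∙ b _ _ ⟩
    δ φ j ∙ δ ψ j ∎
    where b = col (src j)

  δ-at : ∀ φ {j u v} → Joins H j u v → δ φ j ≈ flipIf (col u) (φ v - φ u)
  δ-at φ {j} (inj₁ (≡.refl , ≡.refl)) = refl
  δ-at φ {j} (inj₂ (≡.refl , ≡.refl)) with col (src j) | col (tgt j) | proper j
  ... | true  | true  | c≢c = ⊥-elim (c≢c ≡.refl)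
  ... | true  | false | _   = ⁻¹-anti-homo-// _ _
  ... | false | true  | _   = sym (⁻¹-anti-homo-// _ _)
  ... | false | false | c≢c = ⊥-elim (c≢c ≡.refl)

  cayAdj-δ : (S : SymSubset G) → ∀ φ j → cayAdj G S (φ (src j)) (φ (tgt j)) ≡ SymSubset.mem S (δ φ j)
  cayAdj-δ S φ j with col (src j)
  ... | true  = ≡.sym (SymSubset.symmetric S _)
  ... | false = ≡.refl

  homCount≡∑ᴳ-δ : (S : SymSubset G) →
                  homCount G S H ≡ ∑ᴳ n (λ φ → prodFin k (λ j → f G S (δ φ j)))
  homCount≡∑ᴳ-δ S = sumFuns-cong n (λ φ →
    ≡.trans (𝟙-allFin k _) (prodFin-cong k (λ j → ≡.cong 𝟙 (cayAdj-δ S φ j))))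

  gsum≈sum : ∀ N (x : Fin N → Carrier) → gsum N x ≈ sum x
  gsum≈sum zero    x = refl
  gsum≈sum (suc N) x = ∙-congˡ (gsum≈sum N (x ∘ suc))

  gsum-cong : ∀ N {x y : Fin N → Carrier} → x ≋ y → gsum N x ≈ gsum N y
  gsum-cong N {x} {y} x≋y = trans (gsum≈sum N x) (trans (sum-cong-≋ x≋y) (sym (gsum≈sum N y)))

  natMul-cong : ∀ r {x y} → x ≈ y → natMul r x ≈ natMul r y
  natMul-cong zero    _   = refl
  natMul-cong (suc r) x≈y = ∙-cong x≈y (natMul-cong r x≈y)

  intMul-cong : ∀ z {x y} → x ≈ y → intMul z x ≈ intMul z y
  intMul-cong (+ r)    = natMul-cong r
  intMul-cong -[1+ r ] = ⁻¹-cong ∘ natMul-cong (suc r)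

  intMul-±1 : ∀ {z} → z ≡ + 1 ⊎ z ≡ -[1+ 0 ] → ∀ x → intMul z x ≈ flipIf (isNeg z) x
  intMul-±1 (inj₁ ≡.refl) x = identityʳ x
  intMul-±1 (inj₂ ≡.refl) x = ⁻¹-cong (identityʳ x)

  circuitRow-δ : ∀ {E'} (C : Cycle H E') (ℓ : Fin k → ℤ) → let open Cycle C in
                 (∀ t → ℓ (edges t) ≡ + 1 ⊎ ℓ (edges t) ≡ -[1+ 0 ]) →
                 (∀ t → ℓ (edges (cyc t)) ≡ - ℓ (edges t)) →
                 (∀ j → (∀ t → edges t ≢ j) → ℓ j ≡ + 0) →
                 ∀ φ → gsum k (λ j → intMul (ℓ j) (δ φ j)) ≈ ε
  circuitRow-δ C ℓ unit alternating off-cycle φ = begin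
    gsum k term                                 ≈⟨ gsum≈sum k term ⟩
    sum term                                    ≈⟨ sum-reindex edges einj term vanishes ⟩
    sum (term ∘ edges)                          ≈⟨ sum-cong-≋ along-cycle ⟩
    sum (flipIf (σ zero) ∘ Δ)                   ≈⟨ flipIf-sum (σ zero) Δ ⟩
    flipIf (σ zero) (sum Δ)                     ≈⟨ flipIf-cong (σ zero) telescopes ⟩
    flipIf (σ zero) ε                           ≈⟨ flipIf-ε (σ zero) ⟩
    ε                                           ∎
    where
    open Cycle C
    term : Fin k → Carrier
    term j = intMul (ℓ j) (δ φ j)
    vanishes : ∀ j → (∀ t → edges t ≢ j) → term j ≈ ε
    vanishes j not-on-C rewrite off-cycle j not-on-C = refl
    Δ : Fin (suc p) → Carrier
    Δ t = φ (verts (cyc t)) - φ (verts t)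
    σ : Fin (suc p) → Bool
    σ t = isNeg (ℓ (edges t)) xor col (verts t)
    σ-cyc : ∀ t → σ (cyc t) ≡ σ t
    σ-cyc t rewrite col-flips (joins t) with unit t | alternating t
    ... | inj₁ ℓₜ≡1  | ℓ-next rewrite ℓₜ≡1  | ℓ-next = not-xor-not false (col (verts t))
    ... | inj₂ ℓₜ≡-1 | ℓ-next rewrite ℓₜ≡-1 | ℓ-next = not-xor-not true (col (verts t))
    σ-constant : ∀ t → σ t ≡ σ zero
    σ-constant = cyc-induction (λ t → σ t ≡ σ zero) ≡.refl (λ t σt≡σ₀ → ≡.trans (σ-cyc t) σt≡σ₀)
    along-cycle : ∀ t → term (edges t) ≈ flipIf (σ zero) (Δ t)
    along-cycle t = begin
      intMul (ℓ (edges t)) (δ φ (edges t))               ≈⟨ intMul-±1 (unit t) _ ⟩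
      flipIf s (δ φ (edges t))                           ≈⟨ flipIf-cong s (δ-at φ (joins t)) ⟩
      flipIf s (flipIf (col (verts t)) (Δ t))            ≈⟨ flipIf-xor s (col (verts t)) (Δ t) ⟩
      flipIf (σ t) (Δ t)                                 ≡⟨ ≡.cong (λ b → flipIf b (Δ t)) (σ-constant t) ⟩
      flipIf (σ zero) (Δ t)                              ∎
      where s = isNeg (ℓ (edges t))
    telescopes : sum Δ ≈ ε
    telescopes = trans (sum-- (φ ∘ verts ∘ cyc) (φ ∘ verts)) (x≈y⇒x∙y⁻¹≈ε (sum-rotate (φ ∘ verts)))

  module SpanningTreePotential (simple : Simple H) (T : Fin k → Bool) (tree : SpanningTree H T)
                               (x : Fin k → Carrier) where
    open Walks H (λ j → T j ≡ true)

    weight-flips : ∀ {j u v} → Joins H j u v → flipIf (col v) (x j) ≈ flipIf (col u) (x j) ⁻¹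
    weight-flips {j} {u} J rewrite col-flips J = flipIf-not (col u) (x j)

    open Weights group (λ j u → flipIf (col u) (x j)) weight-flips

    potential : Fin n → Fin n → Carrier
    potential r v = weight (fromWalk (proj₁ tree r v))

    potential-δ : ∀ r j → T j ≡ true → x j ≈ δ (potential r) j
    potential-δ r j Tj = begin
      x j                                         ≈⟨ flipIf-involutive b (x j) ⟨
      flipIf b (flipIf b (x j))                   ≈⟨ flipIf-cong b difference ⟨
      δ ψ j                                       ∎
      where
      b = col (src j)
      ψ = potential r
      walk : ∀ v → Steps r v
      walk v = fromWalk (proj₁ tree r v)
      edge : Steps (src j) (tgt j)
      edge = (j , Tj , inj₁ (≡.refl , ≡.refl)) ◅ []
      along : ψ (tgt j) ≈ ψ (src j) ∙ (flipIf b (x j) ∙ ε)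
      along = trans (weight-pathIndependent simple (proj₂ tree) (walk (tgt j)) (walk (src j) ◅◅ edge))
                    (weight-◅◅ (walk (src j)) edge)
      difference : ψ (tgt j) - ψ (src j) ≈ flipIf b (x j)
      difference = trans (∙-congʳ (trans along (∙-congˡ (identityʳ _)))) (xyx⁻¹≈y _ _)

module CircuitKernel {c ℓ} (G : FiniteAbelianGroup c ℓ) (S : SymSubset G) {n k} (H : Graph n k)
    (col : Fin n → Bool) (proper : ∀ j → col (proj₁ (endpoints H j)) ≢ col (proj₂ (endpoints H j)))
    (T : Fin k → Bool) (tree : SpanningTree H T) {m} (e : Fin m → Fin k) (order : NonTreeOrder T m e)
    (L : Fin m → Fin k → ℤ) (circuit : IsCircuitMatrix H T m e L) where
  open FiniteAbelianGroup G
  open GroupFunctionSums G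
  open AbelianGroupSums abGroup
  open Coboundary G H col proper

  RowsVanish : (Fin k → Carrier) → Set ℓ
  RowsVanish x = ∀ i → gsum k (λ j → intMul (L i j) (x j)) ≈ ε

  isZero-sound : ∀ {y} → isZero y ≡ true → y ≈ ε
  isZero-sound {y} _ with y ≟ ε
  ... | yes y≈ε = y≈ε

  isZero-complete : ∀ {y} → y ≈ ε → isZero y ≡ true
  isZero-complete {y} y≈ε with y ≟ ε
  ... | yes _   = ≡.refl
  ... | no y≉ε = ⊥-elim (y≉ε y≈ε)

  inKer-sound : ∀ {x} → inKer G S L x ≡ true → RowsVanish x
  inKer-sound ker i = isZero-sound (allFin-elim m ker i)

  inKer-complete : ∀ {x} → RowsVanish x → inKer G S L x ≡ true
  inKer-complete rows = allFin-intro m (isZero-complete ∘ rows)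

  inKer-resp : ∀ {x y} → x ≋ y → inKer G S L x ≡ inKer G S L y
  inKer-resp x≋y = bool-ext (inKer-complete ∘ transfer x≋y ∘ inKer-sound)
                            (inKer-complete ∘ transfer (sym ∘ x≋y) ∘ inKer-sound)
    where
    transfer : ∀ {x y} → x ≋ y → RowsVanish x → RowsVanish y
    transfer x≋y rows i = trans (gsum-cong k (λ j → intMul-cong (L i j) (sym (x≋y j)))) (rows i)

  δ-rowsVanish : ∀ φ → RowsVanish (δ φ)
  δ-rowsVanish φ i with circuit i
  ... | C , unit , alternating , off-cycle = circuitRow-δ C (L i) unit alternating off-cycle φ

  nonTreeEdge-onCircuit : ∀ i → ∃ λ t → Cycle.edges (proj₁ (circuit i)) t ≡ e i
  nonTreeEdge-onCircuit i with circuit i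
  ... | C , _ with Fin.any? (λ t → Cycle.edges C t Fin.≟ e i)
  ...   | yes onC = onC
  ...   | no ∉C  = ⊥-elim (proj₂ tree (Cycle-mono C inTree))
    where
    inTree : ∀ t → (T (Cycle.edges C t) ≡ true ⊎ Cycle.edges C t ≡ e i) → T (Cycle.edges C t) ≡ true
    inTree t (inj₁ inT) = inT
    inTree t (inj₂ eᵢ)  = ⊥-elim (∉C (t , eᵢ))

  L-at-nonTreeEdge : ∀ i → L i (e i) ≡ + 1 ⊎ L i (e i) ≡ -[1+ 0 ]
  L-at-nonTreeEdge i with nonTreeEdge-onCircuit i
  ... | t , eₜ≡eᵢ = ≡.subst (λ j → L i j ≡ + 1 ⊎ L i j ≡ -[1+ 0 ]) eₜ≡eᵢ (proj₁ (proj₂ (circuit i)) t)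

  module _ {x ψ} (rows : RowsVanish x) (onTree : ∀ j → T j ≡ true → x j ≈ δ ψ j) where

    row-agrees-off : ∀ i j → j ≢ e i → intMul (L i j) (x j) ≈ intMul (L i j) (δ ψ j)
    row-agrees-off i j j≢eᵢ with circuit i
    ... | C , _ , _ , off-cycle with Fin.any? (λ t → Cycle.edges C t Fin.≟ j)
    ...   | no ∉C rewrite off-cycle j (λ t eₜ≡j → ∉C (t , eₜ≡j)) = refl
    ...   | yes (t , ≡.refl) with Cycle.inE' C t
    ...     | inj₁ inT = intMul-cong (L i j) (onTree j inT)
    ...     | inj₂ eᵢ  = ⊥-elim (j≢eᵢ eᵢ)

    row-agrees-at : ∀ i → intMul (L i (e i)) (x (e i)) ≈ intMul (L i (e i)) (δ ψ (e i))
    row-agrees-at i = summand-determined (e i) (row-agrees-off i) (begin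
      sum (λ j → intMul (L i j) (x j))        ≈⟨ gsum≈sum k _ ⟨
      gsum k (λ j → intMul (L i j) (x j))     ≈⟨ rows i ⟩
      ε                                       ≈⟨ δ-rowsVanish ψ i ⟨
      gsum k (λ j → intMul (L i j) (δ ψ j))   ≈⟨ gsum≈sum k _ ⟩
      sum (λ j → intMul (L i j) (δ ψ j))      ∎)
      where open import Relation.Binary.Reasoning.Setoid setoid

    rowsVanish-extends : x ≋ δ ψ
    rowsVanish-extends j with T j in Tj
    ... | true  = onTree j Tj
    ... | false with proj₂ (proj₂ order) j Tj
    ...   | i , ≡.refl = flipIf-injective (isNeg (L i (e i))) (begin
      flipIf (isNeg (L i (e i))) (x (e i))      ≈⟨ intMul-±1 (L-at-nonTreeEdge i) _ ⟨
      intMul (L i (e i)) (x (e i))              ≈⟨ row-agrees-at i ⟩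
      intMul (L i (e i)) (δ ψ (e i))            ≈⟨ intMul-±1 (L-at-nonTreeEdge i) _ ⟩
      flipIf (isNeg (L i (e i))) (δ ψ (e i))    ∎)
      where open import Relation.Binary.Reasoning.Setoid setoid

  rowsVanish⇒image : Simple H → ∀ {x} → RowsVanish x → ∃ λ ψ → x ≋ δ ψ
  rowsVanish⇒image simple {x} rows with Fin-inhabited? n
  ... | yes r  = potential r , rowsVanish-extends {ψ = potential r} rows (potential-δ r)
    where open SpanningTreePotential simple T tree x
  ... | no ¬Fin = (λ v → ⊥-elim (¬Fin v)) , (λ j → ⊥-elim (¬Fin (src j)))

proposition3 : ∀ {c ℓ} (G : FiniteAbelianGroup c ℓ) (S : SymSubset G)
    (n k : ℕ) (H : Graph n k) → Simple H → Connected H → Bipartite H →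
    (T : Fin k → Bool) → SpanningTree H T →
    (m : ℕ) (e : Fin m → Fin k) → NonTreeOrder T m e →
    (L : Fin m → Fin k → ℤ) → IsCircuitMatrix H T m e L →
    tDensity G S H ≡ kerAverage G S k L
proposition3 G S n k H simple _ (col , proper) T tree m e order L circuit = begin
  ratio (homCount G S H) (size ^ n)                           ≡⟨ ≡.cong₂ ratio homs vertices ⟩
  ratio (kernelSize * ∑ker ∏f) (kernelSize * ∑ker (λ _ → 1))  ≡⟨ ratio-*-cancelˡ kernelSize nonzero ⟩
  kerAverage G S k L                                          ∎
  where
  open ≡.≡-Reasoning
  open FiniteAbelianGroup G using (Carrier; size)
  open SymSubset S using (mem-resp)
  open GroupFunctionSums G
  open Coboundary G H col proper
  open CircuitKernel G S H col proper T tree e order L circuit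
  open Fibres δ δ-cong δ-homo (inKer G S L) inKer-resp (inKer-complete ∘ δ-rowsVanish)
              (λ _ → rowsVanish⇒image simple ∘ inKer-sound)
  ∏f : (Fin k → Carrier) → ℕ
  ∏f x = prodFin k (f G S ∘ x)
  ∑ker : ((Fin k → Carrier) → ℕ) → ℕ
  ∑ker g = ∑ᴳ k (λ x → if inKer G S L x then g x else 0)
  homs : homCount G S H ≡ kernelSize * ∑ker ∏f
  homs = ≡.trans (homCount≡∑ᴳ-δ S) (∑ᴳ-∘D ∏f (λ x≋y → prodFin-cong k (≡.cong 𝟙 ∘ mem-resp ∘ x≋y)))
  vertices : size ^ n ≡ kernelSize * ∑ker (λ _ → 1)
  vertices = ≡.trans (≡.sym (sumFuns-one n)) (∑ᴳ-∘D (λ _ → 1) (λ _ → ≡.refl))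
  nonzero : kernelSize * ∑ker (λ _ → 1) ≢ 0
  nonzero = size≢0 ∘ ℕ.m^n≡0⇒m≡0 size n ∘ ≡.trans vertices
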